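{- Let $G$ be a complete convex geometric graph and let $B$ be a blocker for the family of simple spanning trees of $G$ of diameter at most $3$ which is not a star. Suppose $B$ is a caterpillar with a spine whose terminal edges $[a,a']$ and $[b',b]$ are boundary edges of $\mathrm{conv}(G)$, where $a$ and $b$ are the endpoints (leaves) of the spine and $a'\neq b'$. Let $\alpha$ and $\beta$ be the two closed arcs of the boundary of $\mathrm{conv}(G)$ with endpoints $a$ and $b$, where $\alpha$ is the one containing $a'$ and $b'$. Then every leaf $c$ of $B$ lies on $\beta$.
   Context: A geometric graph is a graph whose vertices are points in the plane in general position (no three collinear) and whose edges are straight segments between pairs of vertices; a complete geometric graph contains all such segments; it is convex if its vertices are in convex position; $\mathrm{conv}(G)$ is the convex hull of $V(G)$. Two edges cross if they share a point other than a common endpoint; a simple spanning tree is a spanning tree of $G$ no two of whose edges cross. For a family $\mathcal{F}$ of subgraphs of $G$, a subgraph $B$ blocks $\mathcal{F}$ if $B$ has at least one edge in common with every member of $\mathcal{F}$; a blocker for $\mathcal{F}$ is a subgraph blocking $\mathcal{F}$ with the smallest possible number of edges among all subgraphs that block $\mathcal{F}$. A star of $G$ is the set of all edges of $G$ incident to a single vertex. A tree is a caterpillar if deleting all its leaves and their incident edges leaves a path (or the empty graph); a spine is a longest path in the caterpillar, and its terminal edges are its first and last edges. -}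

module Defs where

open import Data.Nat as ℕ using (ℕ; zero; suc)
open import Data.Fin using (Fin; toℕ; _≟_)
open import Data.Fin using () renaming (_<_ to _<ᶠ_; _≤_ to _≤ᶠ_)
open import Data.Bool using (Bool; true; false; if_then_else_; _∨_)
open import Data.Product using (Σ; ∃; ∃-syntax; _×_; _,_; proj₁; proj₂)
open import Data.Sum using (_⊎_)
open import Data.List using (List; []; _∷_; _++_; length; filter; allFin)
open import Data.List.Membership.Propositional using (_∈_)
open import Data.List.Relation.Unary.All using (All)
open import Data.List.Relation.Unary.Unique.Propositional using (Unique)
open import Data.Unit using (⊤)
open import Relation.Nullary using (¬_; ⌊_⌋)
open import Relation.Binary.PropositionalEquality using (_≡_)

-- Complete convex geometric graph on n vertices: the vertices are labelled
-- 0,1,...,n-1 in cyclic (say counterclockwise) order around conv(G).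
-- An edge [u,v] is represented by the normalised pair (u , v) with u < v.
Edge : ℕ → Set
Edge n = Fin n × Fin n

EdgeSet : ℕ → Set
EdgeSet n = List (Edge n)

WF : ∀ {n} → EdgeSet n → Set
WF E = All (λ e → proj₁ e <ᶠ proj₂ e) E × Unique E

Adj : ∀ {n} → EdgeSet n → Fin n → Fin n → Set
Adj E u v = ((u , v) ∈ E) ⊎ ((v , u) ∈ E)

-- Crossing of two (normalised) edges of a convex geometric graph:
-- their endpoints interleave in the cyclic order.
Crosses : ∀ {n} → Edge n → Edge n → Set
Crosses (a , b) (c , d) = (a <ᶠ c × c <ᶠ b × b <ᶠ d) ⊎ (c <ᶠ a × a <ᶠ d × d <ᶠ b)

NonCrossing : ∀ {n} → EdgeSet n → Set
NonCrossing E = ∀ e f → e ∈ E → f ∈ E → ¬ Crosses e f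

data Walk {n} (E : EdgeSet n) : Fin n → Fin n → ℕ → Set where
  here : ∀ {u} → Walk E u u 0
  step : ∀ {u v w k} → Adj E u v → Walk E v w k → Walk E u w (suc k)

SpanningTree : ∀ {n} → EdgeSet n → Set
SpanningTree {n} T = WF T × length T ≡ n ℕ.∸ 1 × (∀ u v → ∃[ k ] Walk T u v k)

DiamAtMost3 : ∀ {n} → EdgeSet n → Set
DiamAtMost3 T = ∀ u v → ∃[ k ] (k ℕ.≤ 3 × Walk T u v k)

SimpleST3 : ∀ {n} → EdgeSet n → Set
SimpleST3 T = SpanningTree T × NonCrossing T × DiamAtMost3 T

Blocks : ∀ {n} → EdgeSet n → Set
Blocks {n} B = ∀ (T : EdgeSet n) → SimpleST3 T → ∃[ e ] (e ∈ B × e ∈ T)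

Blocker : ∀ {n} → EdgeSet n → Set
Blocker {n} B = WF B × Blocks B × (∀ (B' : EdgeSet n) → WF B' → Blocks B' → length B ℕ.≤ length B')

StarAt : ∀ {n} → EdgeSet n → Fin n → Set
StarAt {n} B v = ∀ (u w : Fin n) → u <ᶠ w →
  (((u , w) ∈ B) → (u ≡ v ⊎ w ≡ v)) × ((u ≡ v ⊎ w ≡ v) → (u , w) ∈ B)

IsStar : ∀ {n} → EdgeSet n → Set
IsStar {n} B = ∃[ v ] StarAt B v

deg : ∀ {n} → EdgeSet n → Fin n → ℕ
deg [] v = 0
deg ((x , y) ∷ E) v = (if ⌊ x ≟ v ⌋ ∨ ⌊ y ≟ v ⌋ then 1 else 0) ℕ.+ deg E v

InV : ∀ {n} → EdgeSet n → Fin n → Set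
InV B v = 1 ℕ.≤ deg B v

numV : ∀ {n} → EdgeSet n → ℕ
numV {n} B = length (filter (λ v → 1 ℕ.≤? deg B v) (allFin n))

Leaf : ∀ {n} → EdgeSet n → Fin n → Set
Leaf B v = deg B v ≡ 1

Internal : ∀ {n} → EdgeSet n → Fin n → Set
Internal B v = 2 ℕ.≤ deg B v

-- B (with vertex set its non-isolated vertices) is a tree:
-- connected, with |V(B)| = |E(B)| + 1
IsTree : ∀ {n} → EdgeSet n → Set
IsTree B = WF B × (∀ u v → InV B u → InV B v → ∃[ k ] Walk B u v k)
                × numV B ≡ suc (length B)

Consec : ∀ {n} → List (Fin n) → Fin n → Fin n → Set
Consec p u w = (∃[ xs ] ∃[ ys ] p ≡ xs ++ u ∷ w ∷ ys) ⊎ (∃[ xs ] ∃[ ys ] p ≡ xs ++ w ∷ u ∷ ys)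

-- Caterpillar: a tree such that deleting all leaves (and their edges)
-- leaves the empty graph or a path (the remaining vertices are the
-- vertices of degree ≥ 2; the remaining graph is induced on them).
Caterpillar : ∀ {n} → EdgeSet n → Set
Caterpillar {n} B = IsTree B ×
  ((∀ v → ¬ Internal B v) ⊎
   (∃[ p ] (Unique p × (∀ v → (v ∈ p → Internal B v) × (Internal B v → v ∈ p))
            × (∀ u w → Internal B u → Internal B w →
                 (Adj B u w → Consec p u w) × (Consec p u w → Adj B u w)))))

Chain : ∀ {n} → EdgeSet n → List (Fin n) → Set
Chain B [] = ⊤
Chain B (x ∷ []) = ⊤
Chain B (x ∷ y ∷ r) = Adj B x y × Chain B (y ∷ r)

IsPath : ∀ {n} → EdgeSet n → List (Fin n) → Set
IsPath B p = Unique p × Chain B p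

Spine : ∀ {n} → EdgeSet n → List (Fin n) → Set
Spine {n} B p = IsPath B p × (∀ (q : List (Fin n)) → IsPath B q → length q ℕ.≤ length p)

-- [u,v] is a boundary edge of conv(G): u, v cyclically consecutive
HullEdge : ∀ {n} → Fin n → Fin n → Set
HullEdge {n} u v = suc (toℕ u) ≡ toℕ v ⊎ suc (toℕ v) ≡ toℕ u
  ⊎ (toℕ u ≡ 0 × suc (toℕ v) ≡ n) ⊎ (toℕ v ≡ 0 × suc (toℕ u) ≡ n)

-- c lies on the closed arc of the boundary of conv(G) going from x
-- to y in the increasing (counterclockwise) direction
InArc : ∀ {n} → Fin n → Fin n → Fin n → Set
InArc x y c = (x ≤ᶠ y × x ≤ᶠ c × c ≤ᶠ y) ⊎ (y <ᶠ x × (x ≤ᶠ c ⊎ c ≤ᶠ y))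

{-# OPTIONS --safe #-}
-- The spine ends a and b are pendant vertices of B, attached to a' and b': a longest path cannot be
-- extended, and a caterpillar has no cycles since consecutive internal vertices sit at consecutive
-- positions of its central path. Now if c and z are pendant vertices of a blocker with neighbours d
-- and z', then d and z' lie on the same side of the chord cz: otherwise the double star with centres
-- c and z that joins an arc from d to z to the centre z and every other vertex to c is a non-crossing
-- spanning tree of diameter at most 3 meeting B in neither cd nor zz', hence not at all.
-- A leaf c strictly inside α has, as [a,a'] and [b',b] are hull edges, the order a, a', c, b', b;
-- so its neighbour d is separated from a' by the chord ca, or from b' by the chord cb.
module Submission where

open import Defs
open import Data.Nat as ℕ using (ℕ; suc; z≤n)
import Data.Nat.Properties as ℕP
open import Data.Fin using (Fin; toℕ; _≟_; _<?_; punchIn; punchOut) renaming (_<_ to _<ᶠ_; _≤_ to _≤ᶠ_)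
open import Data.Fin.Properties
  using (<-cmp; <-trans; <-irrefl; <-asym; ≤-refl; ≤∧≢⇒<; toℕ<n; punchIn-injective; punchInᵢ≢i; punchIn-punchOut)
open import Data.Bool using (if_then_else_)
open import Data.Empty using (⊥; ⊥-elim)
open import Data.Unit using (tt)
open import Data.List using (List; []; _∷_; _++_; _∷ʳ_; [_]; length; map; allFin; reverse)
open import Data.List.Properties using (length-map; length-tabulate; length-reverse; unfold-reverse; reverse-++; ++-assoc)
open import Data.List.Membership.Propositional.Properties using (∈-map⁺; ∈-map⁻; ∈-allFin; ∈-++⁺ʳ; ∈-∃++)
open import Data.List.Relation.Unary.Unique.Propositional.Properties using (map⁺; allFin⁺)
open import Data.List.Membership.Propositional using (_∈_)
open import Data.List.Relation.Unary.Any using (here; there; any?)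
open import Data.List.Relation.Unary.All using (All; []; _∷_)
import Data.List.Relation.Unary.All as All
import Data.List.Relation.Unary.All.Properties as AllP
open import Data.List.Relation.Unary.AllPairs as AllPairs using ([]; _∷_)
open import Data.List.Relation.Unary.Unique.Propositional using (Unique)
open import Data.List.Relation.Binary.Permutation.Propositional using (_↭_; ↭-sym; ↭⇒↭ₛ)
open import Data.List.Relation.Binary.Permutation.Propositional.Properties using (↭-reverse; ∷↭∷ʳ)
import Data.List.Relation.Binary.Permutation.Setoid.Properties as PermutationSetoid
open import Data.Product as Product using (∃-syntax; _×_; _,_; proj₁; proj₂; swap)
open import Data.Product.Properties using (,-injective)
open import Data.Sum as Sum using (_⊎_; inj₁; inj₂)
open import Function using (_∘_; id)
open import Relation.Nullary using (¬_; Dec; does; yes; no)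
open import Relation.Unary using (Decidable)
open import Relation.Nullary.Decidable using (_×-dec_; _⊎-dec_)
open import Relation.Binary using (tri<; tri≈; tri>)
open import Relation.Binary.PropositionalEquality
  using (_≡_; _≢_; refl; sym; trans; cong; subst; subst₂; ≢-sym; setoid; module ≡-Reasoning)

private
  variable
    n : ℕ
    p q r s t u v w x y z : Fin n

Cyclic : Fin n → Fin n → Fin n → Set
Cyclic x y z = (x <ᶠ y × y <ᶠ z) ⊎ (y <ᶠ z × z <ᶠ x) ⊎ (z <ᶠ x × x <ᶠ y)

cyclic? : (x y z : Fin n) → Dec (Cyclic x y z)
cyclic? x y z = x <? y ×-dec y <? z ⊎-dec y <? z ×-dec z <? x ⊎-dec z <? x ×-dec x <? y

Cyclic-rotate : Cyclic x y z → Cyclic y z x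
Cyclic-rotate (inj₁ p) = inj₂ (inj₂ p)
Cyclic-rotate (inj₂ (inj₁ p)) = inj₁ p
Cyclic-rotate (inj₂ (inj₂ p)) = inj₂ (inj₁ p)

Cyclic-rotate⁻ : Cyclic x y z → Cyclic z x y
Cyclic-rotate⁻ = Cyclic-rotate ∘ Cyclic-rotate

Cyclic-irrefl : ¬ Cyclic x x y
Cyclic-irrefl (inj₁ (x<x , _)) = <-irrefl refl x<x
Cyclic-irrefl (inj₂ (inj₁ (x<y , y<x))) = <-asym x<y y<x
Cyclic-irrefl (inj₂ (inj₂ (_ , x<x))) = <-irrefl refl x<x

Cyclic-asym : Cyclic x y z → ¬ Cyclic x z y
Cyclic-asym (inj₁ (_ , y<z)) (inj₁ (_ , z<y)) = <-asym y<z z<y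
Cyclic-asym (inj₁ (_ , y<z)) (inj₂ (inj₁ (z<y , _))) = <-asym y<z z<y
Cyclic-asym (inj₁ (x<y , _)) (inj₂ (inj₂ (y<x , _))) = <-asym x<y y<x
Cyclic-asym (inj₂ (inj₁ (y<z , _))) (inj₁ (_ , z<y)) = <-asym y<z z<y
Cyclic-asym (inj₂ (inj₁ (y<z , _))) (inj₂ (inj₁ (z<y , _))) = <-asym y<z z<y
Cyclic-asym (inj₂ (inj₁ (_ , z<x))) (inj₂ (inj₂ (_ , x<z))) = <-asym z<x x<z
Cyclic-asym (inj₂ (inj₂ (z<x , _))) (inj₁ (x<z , _)) = <-asym z<x x<z
Cyclic-asym (inj₂ (inj₂ (_ , x<y))) (inj₂ (inj₁ (_ , y<x))) = <-asym x<y y<x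
Cyclic-asym (inj₂ (inj₂ (z<x , _))) (inj₂ (inj₂ (_ , x<z))) = <-asym z<x x<z

Cyclic-trans : Cyclic x y z → Cyclic x z w → Cyclic x y w
Cyclic-trans (inj₁ (x<y , y<z)) (inj₁ (_ , z<w)) = inj₁ (x<y , <-trans y<z z<w)
Cyclic-trans (inj₁ (x<y , y<z)) (inj₂ (inj₁ (z<w , w<x))) = ⊥-elim (<-asym x<y (<-trans y<z (<-trans z<w w<x)))
Cyclic-trans (inj₁ (x<y , _)) (inj₂ (inj₂ (w<x , _))) = inj₂ (inj₂ (w<x , x<y))
Cyclic-trans (inj₂ (inj₁ (_ , z<x))) (inj₁ (x<z , _)) = ⊥-elim (<-asym z<x x<z)
Cyclic-trans (inj₂ (inj₁ (y<z , _))) (inj₂ (inj₁ (z<w , w<x))) = inj₂ (inj₁ (<-trans y<z z<w , w<x))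
Cyclic-trans (inj₂ (inj₁ (_ , z<x))) (inj₂ (inj₂ (_ , x<z))) = ⊥-elim (<-asym z<x x<z)
Cyclic-trans (inj₂ (inj₂ (z<x , _))) (inj₁ (x<z , _)) = ⊥-elim (<-asym z<x x<z)
Cyclic-trans (inj₂ (inj₂ (_ , x<y))) (inj₂ (inj₁ (_ , w<x))) = inj₂ (inj₂ (w<x , x<y))
Cyclic-trans (inj₂ (inj₂ (z<x , _))) (inj₂ (inj₂ (_ , x<z))) = ⊥-elim (<-asym z<x x<z)

Cyclic-total : x ≢ y → y ≢ z → x ≢ z → Cyclic x y z ⊎ Cyclic x z y
Cyclic-total {x = x} {y} {z} x≢y y≢z x≢z with <-cmp x y | <-cmp y z | <-cmp x z
... | tri≈ _ x≡y _ | _ | _ = ⊥-elim (x≢y x≡y)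
... | _ | tri≈ _ y≡z _ | _ = ⊥-elim (y≢z y≡z)
... | _ | _ | tri≈ _ x≡z _ = ⊥-elim (x≢z x≡z)
... | tri< x<y _ _ | tri< y<z _ _ | _ = inj₁ (inj₁ (x<y , y<z))
... | tri< _ _ _ | tri> _ _ z<y | tri< x<z _ _ = inj₂ (inj₁ (x<z , z<y))
... | tri< x<y _ _ | tri> _ _ _ | tri> _ _ z<x = inj₁ (inj₂ (inj₂ (z<x , x<y)))
... | tri> _ _ y<x | tri< _ _ _ | tri< x<z _ _ = inj₂ (inj₂ (inj₂ (y<x , x<z)))
... | tri> _ _ _ | tri< y<z _ _ | tri> _ _ z<x = inj₁ (inj₂ (inj₁ (y<z , z<x)))
... | tri> _ _ y<x | tri> _ _ z<y | _ = inj₂ (inj₂ (inj₁ (z<y , y<x)))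

splitLe : x ≤ᶠ y → x ≡ y ⊎ x <ᶠ y
splitLe {x = x} {y} x≤y with x ≟ y
... | yes x≡y = inj₁ x≡y
... | no x≢y = inj₂ (≤∧≢⇒< x≤y x≢y)

InArc-cases : InArc x y t → t ≡ x ⊎ t ≡ y ⊎ Cyclic x t y
InArc-cases (inj₁ (_ , x≤t , t≤y)) with splitLe x≤t | splitLe t≤y
... | inj₁ x≡t | _ = inj₁ (sym x≡t)
... | inj₂ _ | inj₁ t≡y = inj₂ (inj₁ t≡y)
... | inj₂ x<t | inj₂ t<y = inj₂ (inj₂ (inj₁ (x<t , t<y)))
InArc-cases (inj₂ (y<x , inj₁ x≤t)) with splitLe x≤t
... | inj₁ x≡t = inj₁ (sym x≡t)
... | inj₂ x<t = inj₂ (inj₂ (inj₂ (inj₂ (y<x , x<t))))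
InArc-cases (inj₂ (y<x , inj₂ t≤y)) with splitLe t≤y
... | inj₁ t≡y = inj₂ (inj₁ t≡y)
... | inj₂ t<y = inj₂ (inj₂ (inj₂ (inj₁ (t<y , y<x))))

InArc-start : InArc x y x
InArc-start {x = x} {y} with <-cmp x y
... | tri< x<y _ _ = inj₁ (ℕP.<⇒≤ x<y , ≤-refl , ℕP.<⇒≤ x<y)
... | tri≈ _ refl _ = inj₁ (≤-refl , ≤-refl , ≤-refl)
... | tri> _ _ y<x = inj₂ (y<x , inj₁ ≤-refl)

InArc-end : InArc x y y
InArc-end {x = x} {y} with <-cmp x y
... | tri< x<y _ _ = inj₁ (ℕP.<⇒≤ x<y , ℕP.<⇒≤ x<y , ≤-refl)
... | tri≈ _ refl _ = inj₁ (≤-refl , ≤-refl , ≤-refl)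
... | tri> _ _ y<x = inj₂ (y<x , inj₂ ≤-refl)

Cyclic⇒InArc : Cyclic x t y → InArc x y t
Cyclic⇒InArc (inj₁ (x<t , t<y)) = inj₁ (ℕP.<⇒≤ (<-trans x<t t<y) , ℕP.<⇒≤ x<t , ℕP.<⇒≤ t<y)
Cyclic⇒InArc (inj₂ (inj₁ (t<y , y<x))) = inj₂ (y<x , inj₂ (ℕP.<⇒≤ t<y))
Cyclic⇒InArc (inj₂ (inj₂ (y<x , x<t))) = inj₂ (y<x , inj₁ (ℕP.<⇒≤ x<t))

InArc⇒Cyclic : InArc x y t → t ≢ x → t ≢ y → Cyclic x t y
InArc⇒Cyclic arc t≢x t≢y with InArc-cases arc
... | inj₁ t≡x = ⊥-elim (t≢x t≡x)
... | inj₂ (inj₁ t≡y) = ⊥-elim (t≢y t≡y)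
... | inj₂ (inj₂ xty) = xty

InArc-both : InArc x y t → InArc y x t → t ≡ x ⊎ t ≡ y
InArc-both arc arc′ with InArc-cases arc | InArc-cases arc′
... | inj₁ t≡x | _ = inj₁ t≡x
... | inj₂ (inj₁ t≡y) | _ = inj₂ t≡y
... | _ | inj₁ t≡y = inj₂ t≡y
... | _ | inj₂ (inj₁ t≡x) = inj₁ t≡x
... | inj₂ (inj₂ xty) | inj₂ (inj₂ ytx) = ⊥-elim (Cyclic-asym xty (Cyclic-rotate⁻ ytx))

¬Cyclic⇒InArc : x ≢ y → ¬ Cyclic x t y → InArc y x t
¬Cyclic⇒InArc {x = x} {y} {t} x≢y ¬xty with t ≟ x | t ≟ y
... | yes refl | _ = InArc-end
... | no _ | yes refl = InArc-start
... | no t≢x | no t≢y with Cyclic-total (t≢y ∘ sym) t≢x (x≢y ∘ sym)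
...   | inj₁ ytx = Cyclic⇒InArc ytx
...   | inj₂ yxt = ⊥-elim (¬xty (Cyclic-rotate yxt))

HullEdge-sym : HullEdge u v → HullEdge v u
HullEdge-sym (inj₁ e) = inj₂ (inj₁ e)
HullEdge-sym (inj₂ (inj₁ e)) = inj₁ e
HullEdge-sym (inj₂ (inj₂ (inj₁ e))) = inj₂ (inj₂ (inj₂ e))
HullEdge-sym (inj₂ (inj₂ (inj₂ e))) = inj₂ (inj₂ (inj₁ e))

suc-¬between : suc (toℕ u) ≡ toℕ v → ¬ Cyclic u t v
suc-¬between {u = u} e (inj₁ (u<t , t<v)) = ℕP.<⇒≱ u<t (ℕP.≤-pred (subst (ℕ._<_ _) (sym e) t<v))
suc-¬between {u = u} e (inj₂ (inj₁ (_ , v<u))) = ℕP.<⇒≱ (ℕP.n<1+n (toℕ u)) (ℕP.<⇒≤ (subst (ℕ._< toℕ u) (sym e) v<u))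
suc-¬between {u = u} e (inj₂ (inj₂ (v<u , _))) = ℕP.<⇒≱ (ℕP.n<1+n (toℕ u)) (ℕP.<⇒≤ (subst (ℕ._< toℕ u) (sym e) v<u))

last-first-¬between : {u v t : Fin n} → toℕ u ≡ 0 → suc (toℕ v) ≡ n → ¬ Cyclic v t u
last-first-¬between {v = v} {t} u≡0 v≡n-1 = λ
  { (inj₁ (v<t , _)) → ℕP.<⇒≱ v<t t≤v
  ; (inj₂ (inj₁ (t<u , _))) → ℕP.n≮0 (subst (ℕ._<_ (toℕ t)) u≡0 t<u)
  ; (inj₂ (inj₂ (u<v , v<t))) → ℕP.<⇒≱ v<t t≤v }
  where
  t≤v : toℕ t ℕ.≤ toℕ v
  t≤v = ℕP.≤-pred (subst (suc (toℕ t) ℕ.≤_) (sym v≡n-1) (toℕ<n t))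

HullEdge⇒side-empty : HullEdge u v → (∀ {t} → ¬ Cyclic u t v) ⊎ (∀ {t} → ¬ Cyclic v t u)
HullEdge⇒side-empty (inj₁ e) = inj₁ (suc-¬between e)
HullEdge⇒side-empty (inj₂ (inj₁ e)) = inj₂ (suc-¬between e)
HullEdge⇒side-empty (inj₂ (inj₂ (inj₁ (u≡0 , v≡n-1)))) = inj₂ (last-first-¬between u≡0 v≡n-1)
HullEdge⇒side-empty (inj₂ (inj₂ (inj₂ (v≡0 , u≡n-1)))) = inj₁ (last-first-¬between v≡0 u≡n-1)

HullEdge⇒¬between : HullEdge u v → Cyclic u v w → ¬ Cyclic u t v
HullEdge⇒¬between uv uvw with HullEdge⇒side-empty uv
... | inj₁ empty = empty
... | inj₂ empty = ⊥-elim (empty (Cyclic-rotate uvw))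

edge : Fin n → Fin n → Edge n
edge p q with <-cmp p q
... | tri> _ _ _ = q , p
... | _ = p , q

edge-cases : (p q : Fin n) → edge p q ≡ (p , q) ⊎ edge p q ≡ (q , p)
edge-cases p q with <-cmp p q
... | tri< _ _ _ = inj₁ refl
... | tri≈ _ _ _ = inj₁ refl
... | tri> _ _ _ = inj₂ refl

edge∈⇒Adj : ∀ {E : EdgeSet n} p q → edge p q ∈ E → Adj E p q
edge∈⇒Adj p q e∈E with edge-cases p q
... | inj₁ e = inj₁ (subst (_∈ _) e e∈E)
... | inj₂ e = inj₂ (subst (_∈ _) e e∈E)

edge-ordered : (p q : Fin n) → p ≢ q → proj₁ (edge p q) <ᶠ proj₂ (edge p q)
edge-ordered p q p≢q with <-cmp p q
... | tri< p<q _ _ = p<q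
... | tri≈ _ p≡q _ = ⊥-elim (p≢q p≡q)
... | tri> _ _ q<p = q<p

edge-injective : (p q r s : Fin n) → edge p q ≡ edge r s → (p ≡ r × q ≡ s) ⊎ (p ≡ s × q ≡ r)
edge-injective p q r s eq with edge-cases p q | edge-cases r s
... | inj₁ e | inj₁ e′ = inj₁ (,-injective (trans (sym e) (trans eq e′)))
... | inj₁ e | inj₂ e′ = inj₂ (,-injective (trans (sym e) (trans eq e′)))
... | inj₂ e | inj₁ e′ = inj₂ (swap (,-injective (trans (sym e) (trans eq e′))))
... | inj₂ e | inj₂ e′ = inj₁ (swap (,-injective (trans (sym e) (trans eq e′))))

Crosses-sym : (e f : Edge n) → Crosses e f → Crosses f e
Crosses-sym _ _ (inj₁ c) = inj₂ c
Crosses-sym _ _ (inj₂ c) = inj₁ c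

Separated : Fin n → Fin n → Fin n → Fin n → Set
Separated p q r s = (Cyclic p r q × Cyclic p q s) ⊎ (Cyclic p s q × Cyclic p q r)

Separated-swapˡ : Separated p q r s → Separated q p r s
Separated-swapˡ (inj₁ (prq , pqs)) = inj₂ (Cyclic-rotate pqs , Cyclic-rotate⁻ prq)
Separated-swapˡ (inj₂ (psq , pqr)) = inj₁ (Cyclic-rotate pqr , Cyclic-rotate⁻ psq)

Separated-swapʳ : Separated p q r s → Separated p q s r
Separated-swapʳ (inj₁ sep) = inj₂ sep
Separated-swapʳ (inj₂ sep) = inj₁ sep

¬Separated-shared : ¬ Separated p q r q
¬Separated-shared (inj₁ (_ , pqq)) = Cyclic-irrefl (Cyclic-rotate pqq)
¬Separated-shared (inj₂ (pqq , _)) = Cyclic-irrefl (Cyclic-rotate pqq)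

Crosses-pairs⇒Separated : Crosses (p , q) (r , s) → Separated p q r s
Crosses-pairs⇒Separated (inj₁ (p<r , r<q , q<s)) = inj₁ (inj₁ (p<r , r<q) , inj₁ (<-trans p<r r<q , q<s))
Crosses-pairs⇒Separated (inj₂ (r<p , p<s , s<q)) = inj₂ (inj₁ (p<s , s<q) , inj₂ (inj₂ (r<p , <-trans p<s s<q)))

Crosses⇒Separated : (p q r s : Fin n) → Crosses (edge p q) (edge r s) → Separated p q r s
Crosses⇒Separated p q r s cr with edge-cases p q | edge-cases r s
... | inj₁ e | inj₁ e′ = Crosses-pairs⇒Separated (subst₂ Crosses e e′ cr)
... | inj₁ e | inj₂ e′ = Separated-swapʳ (Crosses-pairs⇒Separated (subst₂ Crosses e e′ cr))
... | inj₂ e | inj₁ e′ = Separated-swapˡ (Crosses-pairs⇒Separated (subst₂ Crosses e e′ cr))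
... | inj₂ e | inj₂ e′ = Separated-swapˡ (Separated-swapʳ (Crosses-pairs⇒Separated (subst₂ Crosses e e′ cr)))

module _ {E : EdgeSet n} where

  Adj-sym : Adj E u v → Adj E v u
  Adj-sym (inj₁ uv) = inj₂ uv
  Adj-sym (inj₂ vu) = inj₁ vu

  Adj-irrefl : WF E → ¬ Adj E u u
  Adj-irrefl (ordered , _) (inj₁ uu) = <-irrefl refl (All.lookup ordered uu)
  Adj-irrefl (ordered , _) (inj₂ uu) = <-irrefl refl (All.lookup ordered uu)

Adj-tail : ∀ {E : EdgeSet n} → p ≢ v → q ≢ v → Adj ((p , q) ∷ E) v x → Adj E v x
Adj-tail p≢v _ (inj₁ (here refl)) = ⊥-elim (p≢v refl)
Adj-tail _ q≢v (inj₂ (here refl)) = ⊥-elim (q≢v refl)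
Adj-tail _ _ (inj₁ (there vx)) = inj₁ vx
Adj-tail _ _ (inj₂ (there xv)) = inj₂ xv

deg≡0⇒¬Adj : ∀ (E : EdgeSet n) → deg E v ≡ 0 → ¬ Adj E v x
deg≡0⇒¬Adj [] _ (inj₁ ())
deg≡0⇒¬Adj [] _ (inj₂ ())
deg≡0⇒¬Adj {v = v} ((p , q) ∷ E) d vx with p ≟ v | q ≟ v
deg≡0⇒¬Adj ((p , q) ∷ E) () vx | yes _ | _
deg≡0⇒¬Adj ((p , q) ∷ E) () vx | no _ | yes _
... | no p≢v | no q≢v = deg≡0⇒¬Adj E d (Adj-tail p≢v q≢v vx)

Adj-head : ∀ {E : EdgeSet n} → deg E v ≡ 0 → Adj ((p , q) ∷ E) v x → (v , x) ≡ (p , q) ⊎ (x , v) ≡ (p , q)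
Adj-head _ (inj₁ (here e)) = inj₁ e
Adj-head _ (inj₂ (here e)) = inj₂ e
Adj-head {E = E} d (inj₁ (there vx)) = ⊥-elim (deg≡0⇒¬Adj E d (inj₁ vx))
Adj-head {E = E} d (inj₂ (there xv)) = ⊥-elim (deg≡0⇒¬Adj E d (inj₂ xv))

Adj-head-unique : ∀ {E : EdgeSet n} → deg E v ≡ 0 → Adj ((p , q) ∷ E) v x → Adj ((p , q) ∷ E) v y → x ≡ y
Adj-head-unique d vx vy with Adj-head d vx | Adj-head d vy
... | inj₁ refl | inj₁ refl = refl
... | inj₁ refl | inj₂ refl = refl
... | inj₂ refl | inj₁ refl = refl
... | inj₂ refl | inj₂ refl = refl

deg≤1⇒Adj-unique : ∀ (E : EdgeSet n) → deg E v ℕ.≤ 1 → Adj E v x → Adj E v y → x ≡ y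
deg≤1⇒Adj-unique [] _ (inj₁ ())
deg≤1⇒Adj-unique [] _ (inj₂ ())
deg≤1⇒Adj-unique {v = v} ((p , q) ∷ E) d vx vy with p ≟ v | q ≟ v
... | no p≢v | no q≢v = deg≤1⇒Adj-unique E d (Adj-tail p≢v q≢v vx) (Adj-tail p≢v q≢v vy)
... | yes _ | _ = Adj-head-unique (ℕP.n≤0⇒n≡0 (ℕP.≤-pred d)) vx vy
... | no _ | yes _ = Adj-head-unique (ℕP.n≤0⇒n≡0 (ℕP.≤-pred d)) vx vy

deg≥1⇒Adj : ∀ (E : EdgeSet n) → 1 ℕ.≤ deg E v → ∃[ x ] Adj E v x
deg≥1⇒Adj [] ()
deg≥1⇒Adj {v = v} ((p , q) ∷ E) d with p ≟ v | q ≟ v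
... | yes refl | _ = q , inj₁ (here refl)
... | no _ | yes refl = p , inj₂ (here refl)
... | no _ | no _ with deg≥1⇒Adj E d
...   | x , inj₁ vx = x , inj₁ (there vx)
...   | x , inj₂ xv = x , inj₂ (there xv)

Leaf⇒unique-neighbour : ∀ (E : EdgeSet n) → Leaf E v → ∃[ d ] (Adj E v d × (∀ {x} → Adj E v x → x ≡ d))
Leaf⇒unique-neighbour E leaf with deg≥1⇒Adj E (ℕP.≤-reflexive (sym leaf))
... | d , vd = d , vd , λ vx → deg≤1⇒Adj-unique E (ℕP.≤-reflexive leaf) vx vd

Adj-distinct⇒Internal : ∀ (E : EdgeSet n) → Adj E v x → Adj E v y → x ≢ y → Internal E v
Adj-distinct⇒Internal {v = v} E vx vy x≢y with 2 ℕ.≤? deg E v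
... | yes internal = internal
... | no ¬internal = ⊥-elim (x≢y (deg≤1⇒Adj-unique E (ℕP.≤-pred (ℕP.≰⇒> ¬internal)) vx vy))

Leaf⇒¬Internal : ∀ (E : EdgeSet n) → Leaf E v → ¬ Internal E v
Leaf⇒¬Internal E leaf internal = ℕP.<-irrefl refl (subst (2 ℕ.≤_) leaf internal)

Walk-++ : ∀ {E : EdgeSet n} {j k} → Walk E u v j → Walk E v w k → Walk E u w (j ℕ.+ k)
Walk-++ here q = q
Walk-++ (step a p) q = step a (Walk-++ p q)

Walk≤1 : ∀ {E : EdgeSet n} → u ≡ v ⊎ Adj E u v → ∃[ k ] (k ℕ.≤ 1 × Walk E u v k)
Walk≤1 (inj₁ refl) = 0 , z≤n , here
Walk≤1 (inj₂ uv) = 1 , ℕP.≤-refl , step uv here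

NoCrossingChords : Fin n → Fin n → (Fin n → Set) → Set
NoCrossingChords c z P = ∀ {v w} → ¬ P v → P w → ¬ Separated v c w z

module DoubleStar {m} (c z : Fin (suc m)) (c≢z : c ≢ z) {P : Fin (suc m) → Set} (P? : Decidable P)
                  (¬Pc : ¬ P c) (¬Pz : ¬ P z) (noCross : NoCrossingChords c z P) where

  HubOf : Fin (suc m) → Fin (suc m) → Set
  HubOf v h = (P v × h ≡ z) ⊎ (¬ P v × h ≡ c)

  hub : Fin (suc m) → Fin (suc m)
  hub v = if does (P? v) then z else c

  hub-spec : ∀ v → HubOf v (hub v)
  hub-spec v with P? v
  ... | yes Pv = inj₁ (Pv , refl)
  ... | no ¬Pv = inj₂ (¬Pv , refl)

  hub-distinct : ∀ v → c ≢ v → v ≢ hub v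
  hub-distinct v c≢v with hub-spec v
  ... | inj₁ (Pv , h≡z) = λ v≡h → ¬Pz (subst P (trans v≡h h≡z) Pv)
  ... | inj₂ (_ , h≡c) = λ v≡h → c≢v (sym (trans v≡h h≡c))

  spoke : Fin (suc m) → Edge (suc m)
  spoke v = edge v (hub v)

  spoke-injective : ∀ {u w} → c ≢ u → c ≢ w → spoke u ≡ spoke w → u ≡ w
  spoke-injective {u} {w} c≢u c≢w eq with edge-injective u (hub u) w (hub w) eq
  ... | inj₁ (u≡w , _) = u≡w
  ... | inj₂ (u≡hw , hu≡w) with hub-spec u | hub-spec w
  ...   | _ | inj₂ (_ , hw≡c) = ⊥-elim (c≢u (sym (trans u≡hw hw≡c)))
  ...   | inj₁ (Pu , _) | inj₁ (_ , hw≡z) = ⊥-elim (¬Pz (subst P (trans u≡hw hw≡z) Pu))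
  ...   | inj₂ (_ , hu≡c) | inj₁ _ = ⊥-elim (c≢w (trans (sym hu≡c) hu≡w))

  tree : EdgeSet (suc m)
  tree = map (spoke ∘ punchIn c) (allFin m)

  spoke∈tree : ∀ {v} → c ≢ v → spoke v ∈ tree
  spoke∈tree c≢v = subst (λ v → spoke v ∈ tree) (punchIn-punchOut c≢v)
    (∈-map⁺ (spoke ∘ punchIn c) (∈-allFin (punchOut c≢v)))

  ∈tree⇒spoke : ∀ {e} → e ∈ tree → ∃[ v ] (c ≢ v × e ≡ spoke v)
  ∈tree⇒spoke e∈ with ∈-map⁻ (spoke ∘ punchIn c) e∈
  ... | j , _ , e≡ = punchIn c j , punchInᵢ≢i c j ∘ sym , e≡

  tree-WF : WF tree
  tree-WF = All.tabulate ordered , map⁺ punchIn-spoke-injective (allFin⁺ m)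
    where
    ordered : ∀ {e} → e ∈ tree → proj₁ e <ᶠ proj₂ e
    ordered e∈ with ∈tree⇒spoke e∈
    ... | v , c≢v , refl = edge-ordered v (hub v) (hub-distinct v c≢v)
    punchIn-spoke-injective : ∀ {i j} → spoke (punchIn c i) ≡ spoke (punchIn c j) → i ≡ j
    punchIn-spoke-injective {i} {j} eq = punchIn-injective c i j
      (spoke-injective (punchInᵢ≢i c i ∘ sym) (punchInᵢ≢i c j ∘ sym) eq)

  tree-length : length tree ≡ m
  tree-length = trans (length-map (spoke ∘ punchIn c) (allFin m)) (length-tabulate id)

  Adj-hub : ∀ v → c ≢ v → Adj tree v (hub v)
  Adj-hub v c≢v = edge∈⇒Adj v (hub v) (spoke∈tree c≢v)

  Adj-z-c : Adj tree z c
  Adj-z-c with hub-spec z | Adj-hub z c≢z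
  ... | inj₁ (Pz , _) | _ = ⊥-elim (¬Pz Pz)
  ... | inj₂ (_ , h≡c) | z~h = subst (Adj tree z) h≡c z~h

  near-hub : ∀ v → v ≡ hub v ⊎ Adj tree v (hub v)
  near-hub v with c ≟ v
  ... | no c≢v = inj₂ (Adj-hub v c≢v)
  ... | yes refl with hub-spec c
  ...   | inj₁ (Pc , _) = ⊥-elim (¬Pc Pc)
  ...   | inj₂ (_ , h≡c) = inj₁ (sym h≡c)

  hubs-near : ∀ u v → hub u ≡ hub v ⊎ Adj tree (hub u) (hub v)
  hubs-near u v with hub-spec u | hub-spec v
  ... | inj₁ (_ , hu≡z) | inj₁ (_ , hv≡z) = inj₁ (trans hu≡z (sym hv≡z))
  ... | inj₁ (_ , hu≡z) | inj₂ (_ , hv≡c) = inj₂ (subst₂ (Adj tree) (sym hu≡z) (sym hv≡c) Adj-z-c)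
  ... | inj₂ (_ , hu≡c) | inj₁ (_ , hv≡z) = inj₂ (subst₂ (Adj tree) (sym hu≡c) (sym hv≡z) (Adj-sym Adj-z-c))
  ... | inj₂ (_ , hu≡c) | inj₂ (_ , hv≡c) = inj₁ (trans hu≡c (sym hv≡c))

  tree-diameter : DiamAtMost3 tree
  tree-diameter u v
    with Walk≤1 (near-hub u) | Walk≤1 (hubs-near u v) | Walk≤1 (Sum.map sym Adj-sym (near-hub v))
  ... | i , i≤1 , p | j , j≤1 , q | k , k≤1 , r =
    i ℕ.+ (j ℕ.+ k) , ℕP.+-mono-≤ i≤1 (ℕP.+-mono-≤ j≤1 k≤1) , Walk-++ p (Walk-++ q r)

  spokes-¬Crosses : ∀ {v w hv hw} → HubOf v hv → HubOf w hw → ¬ Crosses (edge v hv) (edge w hw)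
  spokes-¬Crosses {v} {w} (inj₁ (_ , refl)) (inj₁ (_ , refl)) cr = ¬Separated-shared (Crosses⇒Separated v z w z cr)
  spokes-¬Crosses {v} {w} (inj₂ (_ , refl)) (inj₂ (_ , refl)) cr = ¬Separated-shared (Crosses⇒Separated v c w c cr)
  spokes-¬Crosses {v} {w} (inj₂ (¬Pv , refl)) (inj₁ (Pw , refl)) cr = noCross ¬Pv Pw (Crosses⇒Separated v c w z cr)
  spokes-¬Crosses {v} {w} (inj₁ (Pv , refl)) (inj₂ (¬Pw , refl)) cr =
    noCross ¬Pw Pv (Crosses⇒Separated w c v z (Crosses-sym (edge v z) (edge w c) cr))

  tree-NonCrossing : NonCrossing tree
  tree-NonCrossing _ _ e∈ f∈ with ∈tree⇒spoke e∈ | ∈tree⇒spoke f∈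
  ... | v , _ , refl | w , _ , refl = spokes-¬Crosses (hub-spec v) (hub-spec w)

  tree-SimpleST3 : SimpleST3 tree
  tree-SimpleST3 =
    (tree-WF , tree-length , λ u v → Product.map₂ proj₂ (tree-diameter u v)) , tree-NonCrossing , tree-diameter

ArcTo ArcFrom : Fin n → Fin n → Fin n → Fin n → Set
ArcTo c d z x = x ≡ d ⊎ (Cyclic c d x × Cyclic c x z)
ArcFrom c z d x = x ≡ d ⊎ (Cyclic c z x × Cyclic c x d)

arcTo? : (c d z : Fin n) → Decidable (ArcTo c d z)
arcTo? c d z x = x ≟ d ⊎-dec cyclic? c d x ×-dec cyclic? c x z

arcFrom? : (c z d : Fin n) → Decidable (ArcFrom c z d)
arcFrom? c z d x = x ≟ d ⊎-dec cyclic? c z x ×-dec cyclic? c x d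

module _ {c d z : Fin n} (cdz : Cyclic c d z) where

  ArcTo-∌centre : ¬ ArcTo c d z c
  ArcTo-∌centre (inj₁ refl) = Cyclic-irrefl cdz
  ArcTo-∌centre (inj₂ (cdc , _)) = Cyclic-irrefl (Cyclic-rotate⁻ cdc)

  ArcTo-∌end : ¬ ArcTo c d z z
  ArcTo-∌end (inj₁ refl) = Cyclic-irrefl (Cyclic-rotate cdz)
  ArcTo-∌end (inj₂ (_ , czz)) = Cyclic-irrefl (Cyclic-rotate czz)

  ArcTo-noCrossing : NoCrossingChords c z (ArcTo c d z)
  ArcTo-noCrossing ¬Pv Pw (inj₁ (vwc , vcz)) =
    Cyclic-asym (Cyclic-trans (Cyclic-rotate vcz) (Cyclic-rotate⁻ vwc)) (before-end Pw)
    where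
    before-end : ∀ {w} → ArcTo c d z w → Cyclic c w z
    before-end (inj₁ refl) = cdz
    before-end (inj₂ (_ , cwz)) = cwz
  ArcTo-noCrossing ¬Pv Pw (inj₂ (vzc , vcw)) = ¬Pv (inj₂ (after-start Pw (Cyclic-rotate vcw) , Cyclic-rotate⁻ vzc))
    where
    after-start : ∀ {v w} → ArcTo c d z w → Cyclic c w v → Cyclic c d v
    after-start (inj₁ refl) cwv = cwv
    after-start (inj₂ (cdw , _)) cwv = Cyclic-trans cdw cwv

module _ {c z d : Fin n} (czd : Cyclic c z d) where

  ArcFrom-∌centre : ¬ ArcFrom c z d c
  ArcFrom-∌centre (inj₁ refl) = Cyclic-irrefl (Cyclic-rotate⁻ czd)
  ArcFrom-∌centre (inj₂ (czc , _)) = Cyclic-irrefl (Cyclic-rotate⁻ czc)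

  ArcFrom-∌end : ¬ ArcFrom c z d z
  ArcFrom-∌end (inj₁ refl) = Cyclic-irrefl (Cyclic-rotate czd)
  ArcFrom-∌end (inj₂ (czz , _)) = Cyclic-irrefl (Cyclic-rotate czz)

  ArcFrom-noCrossing : NoCrossingChords c z (ArcFrom c z d)
  ArcFrom-noCrossing ¬Pv Pw (inj₁ (vwc , vcz)) = ¬Pv (inj₂ (Cyclic-rotate vcz , before-end Pw (Cyclic-rotate⁻ vwc)))
    where
    before-end : ∀ {v w} → ArcFrom c z d w → Cyclic c v w → Cyclic c v d
    before-end (inj₁ refl) cvw = cvw
    before-end (inj₂ (_ , cwd)) cvw = Cyclic-trans cvw cwd
  ArcFrom-noCrossing ¬Pv Pw (inj₂ (vzc , vcw)) =
    Cyclic-asym (Cyclic-trans (after-start Pw) (Cyclic-rotate vcw)) (Cyclic-rotate⁻ vzc)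
    where
    after-start : ∀ {w} → ArcFrom c z d w → Cyclic c z w
    after-start (inj₁ refl) = czd
    after-start (inj₂ (czw , _)) = czw

Blocks⇒¬pendants-split : ∀ {B : EdgeSet n} {c d z z'} → Blocks B → c ≢ z →
  {P : Fin n → Set} → Decidable P → ¬ P c → ¬ P z → NoCrossingChords c z P →
  (∀ {x} → Adj B c x → x ≡ d) → (∀ {x} → Adj B z x → x ≡ z') → P d → ¬ P z' → ⊥
Blocks⇒¬pendants-split {n = suc m} {B} {c} {d} {z} {z'} blocks c≢z {P} P? ¬Pc ¬Pz noCross c-end z-end Pd ¬Pz' =
  avoided (blocks tree tree-SimpleST3)
  where
  open DoubleStar c z c≢z P? ¬Pc ¬Pz noCross
  spoke∉B : ∀ {v h} → HubOf v h → ¬ Adj B v h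
  spoke∉B (inj₁ (Pv , refl)) vz = ¬Pz' (subst P (z-end (Adj-sym vz)) Pv)
  spoke∉B (inj₂ (¬Pv , refl)) vc = ¬Pv (subst P (sym (c-end (Adj-sym vc))) Pd)
  avoided : ¬ (∃[ e ] (e ∈ B × e ∈ tree))
  avoided (e , e∈B , e∈tree) with ∈tree⇒spoke e∈tree
  ... | v , _ , refl = spoke∉B (hub-spec v) (edge∈⇒Adj v (hub v) e∈B)

Blocks⇒pendants-same-side : ∀ {B : EdgeSet n} {c d z z'} → Blocks B →
  (∀ {x} → Adj B c x → x ≡ d) → (∀ {x} → Adj B z x → x ≡ z') → ¬ Separated c z d z'
Blocks⇒pendants-same-side {c = c} {d} {z} {z'} blocks c-end z-end (inj₁ (cdz , czz')) =
  Blocks⇒¬pendants-split blocks (λ { refl → Cyclic-irrefl (Cyclic-rotate⁻ cdz) }) (arcTo? c d z)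
    (ArcTo-∌centre cdz) (ArcTo-∌end cdz) (ArcTo-noCrossing cdz) c-end z-end (inj₁ refl) ¬ArcTo-z'
  where
  ¬ArcTo-z' : ¬ ArcTo c d z z'
  ¬ArcTo-z' (inj₁ refl) = Cyclic-asym cdz czz'
  ¬ArcTo-z' (inj₂ (_ , cz'z)) = Cyclic-asym czz' cz'z
Blocks⇒pendants-same-side {c = c} {d} {z} {z'} blocks c-end z-end (inj₂ (cz'z , czd)) =
  Blocks⇒¬pendants-split blocks (λ { refl → Cyclic-irrefl czd }) (arcFrom? c z d)
    (ArcFrom-∌centre czd) (ArcFrom-∌end czd) (ArcFrom-noCrossing czd) c-end z-end (inj₁ refl) ¬ArcFrom-z'
  where
  ¬ArcFrom-z' : ¬ ArcFrom c z d z'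
  ¬ArcFrom-z' (inj₁ refl) = Cyclic-asym czd cz'z
  ¬ArcFrom-z' (inj₂ (czz' , _)) = Cyclic-asym cz'z czz'

record SpineEnds (B : EdgeSet n) (a a' b' b : Fin n) : Set where
  field
    a-end : ∀ {x} → Adj B a x → x ≡ a'
    b-end : ∀ {x} → Adj B b x → x ≡ b'
    a'-internal : Internal B a'
    b'-internal : Internal B b'
    a≢b : a ≢ b
    a'≢a : a' ≢ a
    a'≢b : a' ≢ b
    b'≢a : b' ≢ a
    b'≢b : b' ≢ b

SpineEnds-swap : ∀ {B : EdgeSet n} {a a' b' b} → SpineEnds B a a' b' b → SpineEnds B b b' a' a
SpineEnds-swap ends = record
  { a-end = b-end ; b-end = a-end ; a'-internal = b'-internal ; b'-internal = a'-internal
  ; a≢b = ≢-sym a≢b ; a'≢a = b'≢b ; a'≢b = b'≢a ; b'≢a = a'≢b ; b'≢b = a'≢a }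
  where open SpineEnds ends

Leaf-¬between-ends : ∀ {B : EdgeSet n} {a a' b' b c} → WF B → Blocks B → SpineEnds B a a' b' b →
  (∀ {t} → ¬ Cyclic a t a') → (∀ {t} → ¬ Cyclic b' t b) → Leaf B c → ¬ Cyclic a c b
Leaf-¬between-ends {n} {B} {a} {a'} {b'} {b} {c} wf blocks ends a-side b-side leaf acb =
  let d , cd , c-end = Leaf⇒unique-neighbour B leaf in
  Sum.[ (λ cda → Blocks⇒pendants-same-side blocks c-end a-end (inj₁ (cda , caa')))
      , (λ cad → Blocks⇒pendants-same-side blocks c-end b-end (inj₂ (cb'b , Cyclic-trans cba cad)))
      ]′ (Cyclic-total (c≢neighbour cd) (neighbour≢a cd) c≢a)
  where
  open SpineEnds ends

  c≢a : c ≢ a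
  c≢a refl = Cyclic-irrefl acb

  c≢b : c ≢ b
  c≢b refl = Cyclic-irrefl (Cyclic-rotate acb)

  c≢neighbour : Adj B c x → c ≢ x
  c≢neighbour cx refl = Adj-irrefl wf cx

  neighbour≢a : Adj B c x → x ≢ a
  neighbour≢a cx refl = Leaf⇒¬Internal B leaf (subst (Internal B) (sym (a-end (Adj-sym cx))) a'-internal)

  cba : Cyclic c b a
  cba = Cyclic-rotate acb

  caa' : Cyclic c a a'
  caa' with Cyclic-total (≢-sym a'≢a) (λ { refl → Leaf⇒¬Internal B leaf a'-internal }) (≢-sym c≢a)
  ... | inj₁ aa'c = Cyclic-rotate⁻ aa'c
  ... | inj₂ aca' = ⊥-elim (a-side aca')

  cb'b : Cyclic c b' b
  cb'b with Cyclic-total (λ { refl → Leaf⇒¬Internal B leaf b'-internal }) c≢b b'≢b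
  ... | inj₁ b'cb = ⊥-elim (b-side b'cb)
  ... | inj₂ b'bc = Cyclic-rotate (Cyclic-rotate b'bc)

module _ {B : EdgeSet n} where

  Chain-++⁻ˡ : ∀ xs {ys} → Chain B (xs ++ ys) → Chain B xs
  Chain-++⁻ˡ [] _ = tt
  Chain-++⁻ˡ (x ∷ []) _ = tt
  Chain-++⁻ˡ (x ∷ y ∷ xs) (xy , chain) = xy , Chain-++⁻ˡ (y ∷ xs) chain

  Chain-∷ʳ : ∀ xs → Chain B (xs ∷ʳ y) → Adj B y x → Chain B (xs ∷ʳ y ∷ʳ x)
  Chain-∷ʳ [] _ yx = yx , tt
  Chain-∷ʳ (u ∷ []) (uy , _) yx = uy , yx , tt
  Chain-∷ʳ (u ∷ v ∷ xs) (uv , chain) yx = uv , Chain-∷ʳ (v ∷ xs) chain yx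

  Chain-reverse : ∀ xs → Chain B xs → Chain B (reverse xs)
  Chain-reverse [] _ = tt
  Chain-reverse (x ∷ []) _ = tt
  Chain-reverse (x ∷ y ∷ xs) (xy , chain) = subst (Chain B) (sym reverse-∷∷)
    (Chain-∷ʳ (reverse xs) (subst (Chain B) (unfold-reverse y xs) (Chain-reverse (y ∷ xs) chain)) (Adj-sym xy))
    where
    reverse-∷∷ : reverse (x ∷ y ∷ xs) ≡ reverse xs ∷ʳ y ∷ʳ x
    reverse-∷∷ = trans (unfold-reverse x (y ∷ xs)) (cong (_∷ʳ x) (unfold-reverse y xs))

Unique-resp-↭ : ∀ {xs ys : List (Fin n)} → xs ↭ ys → Unique xs → Unique ys
Unique-resp-↭ {n} xs↭ys = PermutationSetoid.Unique-resp-↭ (setoid (Fin n)) (↭⇒↭ₛ xs↭ys)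

Unique-++⁻ˡ : ∀ (xs : List (Fin n)) {ys} → Unique (xs ++ ys) → Unique xs
Unique-++⁻ˡ [] _ = []
Unique-++⁻ˡ (x ∷ xs) (x∉ ∷ xs!) = AllP.++⁻ˡ xs x∉ ∷ Unique-++⁻ˡ xs xs!

module _ {B : EdgeSet n} where

  IsPath-++⁻ˡ : ∀ xs {ys} → IsPath B (xs ++ ys) → IsPath B xs
  IsPath-++⁻ˡ xs (xs! , chain) = Unique-++⁻ˡ xs xs! , Chain-++⁻ˡ xs chain

  IsPath-reverse : ∀ {xs} → IsPath B xs → IsPath B (reverse xs)
  IsPath-reverse {xs} (xs! , chain) = Unique-resp-↭ (↭-sym (↭-reverse xs)) xs! , Chain-reverse xs chain

  Spine-reverse : ∀ {xs} → Spine B xs → Spine B (reverse xs)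
  Spine-reverse {xs} (path , longest) =
    IsPath-reverse path , λ q q-path → ℕP.≤-trans (longest q q-path) (ℕP.≤-reflexive (sym (length-reverse xs)))

  Path-interior-Internal : ∀ u vs w → IsPath B (u ∷ vs ∷ʳ w) → All (Internal B) vs
  Path-interior-Internal u [] w _ = []
  Path-interior-Internal u (v ∷ []) w ((_ ∷ u≢w ∷ []) ∷ _ , uv , vw , _) =
    Adj-distinct⇒Internal B (Adj-sym uv) vw u≢w ∷ []
  Path-interior-Internal u (v ∷ v' ∷ vs) w ((_ ∷ u≢v' ∷ _) ∷ path! , uv , vv' , chain) =
    Adj-distinct⇒Internal B (Adj-sym uv) vv' u≢v' ∷ Path-interior-Internal v (v' ∷ vs) w (path! , vv' , chain)

position : Fin n → List (Fin n) → ℕ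
position v [] = 0
position v (w ∷ ws) with v ≟ w
... | yes _ = 0
... | no _ = suc (position v ws)

position-here : ∀ (v : Fin n) ws → position v (v ∷ ws) ≡ 0
position-here v ws with v ≟ v
... | yes _ = refl
... | no v≢v = ⊥-elim (v≢v refl)

position-there : ∀ {ws} → v ≢ w → position v (w ∷ ws) ≡ suc (position v ws)
position-there {v = v} {w} v≢w with v ≟ w
... | yes v≡w = ⊥-elim (v≢w v≡w)
... | no _ = refl

position-injective : ∀ ws → u ∈ ws → w ∈ ws → position u ws ≡ position w ws → u ≡ w
position-injective {u = u} {w} (y ∷ ws) u∈ w∈ eq with u ≟ y | w ≟ y
... | yes u≡y | yes w≡y = trans u≡y (sym w≡y)
position-injective (y ∷ ws) u∈ w∈ () | yes _ | no _
position-injective (y ∷ ws) u∈ w∈ () | no _ | yes _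
position-injective (y ∷ ws) (here u≡y) _ _ | no u≢y | no _ = ⊥-elim (u≢y u≡y)
position-injective (y ∷ ws) (there _) (here w≡y) _ | no _ | no w≢y = ⊥-elim (w≢y w≡y)
position-injective (y ∷ ws) (there u∈) (there w∈) eq | no _ | no _ = position-injective ws u∈ w∈ (ℕP.suc-injective eq)

position-next : ∀ xs {ys} → Unique (xs ++ u ∷ w ∷ ys) →
  position w (xs ++ u ∷ w ∷ ys) ≡ suc (position u (xs ++ u ∷ w ∷ ys))
position-next {u = u} {w} [] {ys} ((u≢w ∷ _) ∷ _) = begin
  position w (u ∷ w ∷ ys)      ≡⟨ position-there (≢-sym u≢w) ⟩
  suc (position w (w ∷ ys))    ≡⟨ cong suc (position-here w ys) ⟩
  1                            ≡⟨ cong suc (sym (position-here u (w ∷ ys))) ⟩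
  suc (position u (u ∷ w ∷ ys)) ∎
  where open ≡-Reasoning
position-next {u = u} {w} (x ∷ xs) {ys} (x∉ ∷ xs!) = begin
  position w (x ∷ xs ++ u ∷ w ∷ ys)        ≡⟨ position-there w≢x ⟩
  suc (position w (xs ++ u ∷ w ∷ ys))       ≡⟨ cong suc (position-next xs xs!) ⟩
  suc (suc (position u (xs ++ u ∷ w ∷ ys))) ≡⟨ cong suc (sym (position-there u≢x)) ⟩
  suc (position u (x ∷ xs ++ u ∷ w ∷ ys))   ∎
  where
  open ≡-Reasoning
  u≢x : u ≢ x
  u≢x = ≢-sym (All.lookup x∉ (∈-++⁺ʳ xs (here refl)))
  w≢x : w ≢ x
  w≢x = ≢-sym (All.lookup x∉ (∈-++⁺ʳ xs (there (here refl))))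

Consec⇒positions-adjacent : ∀ {p} → Unique p → Consec p u w →
  suc (position u p) ≡ position w p ⊎ suc (position w p) ≡ position u p
Consec⇒positions-adjacent p! (inj₁ (xs , _ , refl)) = inj₁ (sym (position-next xs p!))
Consec⇒positions-adjacent p! (inj₂ (xs , _ , refl)) = inj₂ (sym (position-next xs p!))

module CaterpillarPositions {B : EdgeSet n} (p : List (Fin n)) (p! : Unique p)
  (internal⇒∈ : ∀ {v} → Internal B v → v ∈ p)
  (adjacent⇒consecutive : ∀ {u w} → Internal B u → Internal B w → Adj B u w → Consec p u w) where

  pos : Fin n → ℕ
  pos v = position v p

  pos-step : Internal B u → Internal B w → Adj B u w → suc (pos u) ≡ pos w ⊎ suc (pos w) ≡ pos u
  pos-step iu iw uw = Consec⇒positions-adjacent p! (adjacent⇒consecutive iu iw uw)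

  pos-injective : Internal B u → Internal B w → pos u ≡ pos w → u ≡ w
  pos-injective iu iw = position-injective p (internal⇒∈ iu) (internal⇒∈ iw)

  ascending : ∀ r → suc (pos x) ≡ pos y → All (Internal B) (x ∷ y ∷ r) → IsPath B (x ∷ y ∷ r) →
              All (λ v → pos y ℕ.≤ pos v) (y ∷ r)
  ascending [] _ _ _ = ℕP.≤-refl ∷ []
  ascending (z ∷ r) up (ix ∷ iy ∷ iz ∷ ir) ((_ ∷ x≢z ∷ _) ∷ yzr! , _ , yz , chain) with pos-step iy iz yz
  ... | inj₂ down = ⊥-elim (x≢z (pos-injective ix iz (ℕP.suc-injective (trans up (sym down)))))
  ... | inj₁ up′ = ℕP.≤-refl ∷ All.map (ℕP.≤-trans (ℕP.≤-trans (ℕP.n≤1+n _) (ℕP.≤-reflexive up′)))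
                               (ascending r up′ (iy ∷ iz ∷ ir) (yzr! , yz , chain))

  descending : ∀ r → suc (pos y) ≡ pos x → All (Internal B) (x ∷ y ∷ r) → IsPath B (x ∷ y ∷ r) →
               All (λ v → pos v ℕ.≤ pos y) (y ∷ r)
  descending [] _ _ _ = ℕP.≤-refl ∷ []
  descending (z ∷ r) down (ix ∷ iy ∷ iz ∷ ir) ((_ ∷ x≢z ∷ _) ∷ yzr! , _ , yz , chain) with pos-step iy iz yz
  ... | inj₁ up = ⊥-elim (x≢z (pos-injective ix iz (trans (sym down) up)))
  ... | inj₂ down′ = ℕP.≤-refl ∷ All.map (λ v≤z → ℕP.≤-trans v≤z (ℕP.≤-trans (ℕP.n≤1+n _) (ℕP.≤-reflexive down′)))
                                 (descending r down′ (iy ∷ iz ∷ ir) (yzr! , yz , chain))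

  -- Going around the cycle, positions move monotonically away from pos x, so the closing step cannot be ±1.
  ¬cycle : ∀ zs → All (Internal B) (x ∷ y ∷ zs ∷ʳ w) → IsPath B (x ∷ y ∷ zs ∷ʳ w) → ¬ Adj B w x
  ¬cycle {x = x} {y} {w} zs internal path@((_ ∷ (y∉ ∷ _)) , xy , _) wx =
    closing (pos-step ix iy xy) (pos-step ix iw (Adj-sym wx))
    where
    w∈ : w ∈ y ∷ zs ∷ʳ w
    w∈ = ∈-++⁺ʳ (y ∷ zs) (here refl)
    ix : Internal B x
    ix = All.lookup internal (here refl)
    iy : Internal B y
    iy = All.lookup internal (there (here refl))
    iw : Internal B w
    iw = All.lookup internal (there w∈)

    py≢pw : pos y ≢ pos w
    py≢pw = All.lookup y∉ (∈-++⁺ʳ zs (here refl)) ∘ pos-injective iy iw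

    closing : suc (pos x) ≡ pos y ⊎ suc (pos y) ≡ pos x → suc (pos x) ≡ pos w ⊎ suc (pos w) ≡ pos x → ⊥
    closing (inj₁ up) (inj₁ x→w) = py≢pw (trans (sym up) x→w)
    closing (inj₁ up) (inj₂ w→x) =
      ℕP.<-asym (ℕP.≤∧≢⇒< (All.lookup (ascending (zs ∷ʳ w) up internal path) w∈) py≢pw)
                (ℕP.<-trans (ℕP.≤-reflexive w→x) (ℕP.≤-reflexive up))
    closing (inj₂ down) (inj₁ x→w) =
      ℕP.<-asym (ℕP.≤∧≢⇒< (All.lookup (descending (zs ∷ʳ w) down internal path) w∈) (py≢pw ∘ sym))
                (ℕP.<-trans (ℕP.≤-reflexive down) (ℕP.≤-reflexive x→w))
    closing (inj₂ down) (inj₂ w→x) = py≢pw (ℕP.suc-injective (trans down (sym w→x)))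

Caterpillar⇒¬cycle : ∀ {B : EdgeSet n} → Caterpillar B → ∀ zs → IsPath B (x ∷ y ∷ zs ∷ʳ w) → ¬ Adj B w x
Caterpillar⇒¬cycle {x = x} {y} {w} {B} (_ , shape) zs path@((_ ∷ (y∉ ∷ _)) , xy , chain) wx = Sum.[
    (λ no-internal → no-internal x ix) ,
    (λ (p , p! , internal⇔∈ , adjacent⇔consecutive) →
      CaterpillarPositions.¬cycle p p! (proj₂ (internal⇔∈ _)) (λ iu iw → proj₁ (adjacent⇔consecutive _ _ iu iw))
        zs (ix ∷ iy ∷ rest) path wx)
  ]′ shape
  where
  ix : Internal B x
  ix = Adj-distinct⇒Internal B xy (Adj-sym wx) (All.lookup y∉ (∈-++⁺ʳ zs (here refl)))
  iy : Internal B y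
  iy = All.head (Path-interior-Internal x (y ∷ zs) w path)
  rotated : IsPath B (y ∷ (zs ∷ʳ w) ∷ʳ x)
  rotated = Unique-resp-↭ (∷↭∷ʳ x (y ∷ zs ∷ʳ w)) (proj₁ path) , Chain-∷ʳ (y ∷ zs) chain wx
  rest : All (Internal B) (zs ∷ʳ w)
  rest = Path-interior-Internal y (zs ∷ʳ w) x rotated

Spine-start-neighbour : ∀ {B : EdgeSet n} {u u' r} → Caterpillar B → Spine B (u ∷ u' ∷ r) → Adj B u x → x ≡ u'
Spine-start-neighbour {x = x} {B} {u} {u'} {r} cat (path@(path! , chain) , longest) ux
  with any? (x ≟_) (u ∷ u' ∷ r)
... | no x∉ = ⊥-elim (ℕP.<-irrefl refl (longest (x ∷ u ∷ u' ∷ r) longer))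
  where
  longer : IsPath B (x ∷ u ∷ u' ∷ r)
  longer = AllP.¬Any⇒All¬ _ x∉ ∷ path! , Adj-sym ux , chain
... | yes (here refl) = ⊥-elim (Adj-irrefl (proj₁ (proj₁ cat)) ux)
... | yes (there (here x≡u')) = x≡u'
... | yes (there (there x∈r)) with ∈-∃++ x∈r
...   | pre , post , refl = ⊥-elim (Caterpillar⇒¬cycle cat pre closed-prefix (Adj-sym ux))
  where
  closed-prefix : IsPath B (u ∷ u' ∷ pre ∷ʳ x)
  closed-prefix = IsPath-++⁻ˡ (u ∷ u' ∷ pre ∷ʳ x)
    (subst (IsPath B) (cong (λ t → u ∷ u' ∷ t) (sym (++-assoc pre [ x ] post))) path)

Spine⇒SpineEnds : ∀ {B : EdgeSet n} {a a' b' b} mid → Caterpillar B → Spine B (a ∷ a' ∷ mid ++ b' ∷ b ∷ []) →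
  SpineEnds B a a' b' b
Spine⇒SpineEnds {B = B} {a} {a'} {b'} {b} mid cat spine@(path@((a∉ ∷ a'∉ ∷ _) , _) , _) = record
  { a-end = Spine-start-neighbour cat spine
  ; b-end = Spine-start-neighbour cat reversed
  ; a'-internal = All.head interior
  ; b'-internal = All.lookup interior (∈-++⁺ʳ (a' ∷ mid) (here refl))
  ; a≢b = All.lookup a∉ (there (∈-++⁺ʳ mid (there (here refl))))
  ; a'≢a = ≢-sym (All.lookup a∉ (here refl))
  ; a'≢b = All.lookup a'∉ (∈-++⁺ʳ mid (there (here refl)))
  ; b'≢a = ≢-sym (All.lookup a∉ (there (∈-++⁺ʳ mid (here refl))))
  ; b'≢b = ≢-sym (All.lookup (AllPairs.head (proj₁ (proj₁ reversed))) (here refl))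
  }
  where
  reversed : Spine B (b ∷ b' ∷ reverse (a ∷ a' ∷ mid))
  reversed = subst (Spine B) (reverse-++ (a ∷ a' ∷ mid) (b' ∷ b ∷ [])) (Spine-reverse spine)
  interior : All (Internal B) (a' ∷ mid ∷ʳ b')
  interior = Path-interior-Internal a (a' ∷ mid ∷ʳ b') b
    (subst (IsPath B) (cong (λ t → a ∷ a' ∷ t) (sym (++-assoc mid [ b' ] [ b ]))) path)

Leaf-on-far-arc : ∀ {B : EdgeSet n} {a a' b' b c} → WF B → Blocks B → SpineEnds B a a' b' b →
  HullEdge a a' → HullEdge b' b → InArc a b a' → InArc a b b' → Leaf B c → InArc b a c
Leaf-on-far-arc {a = a} {a'} {b'} {b} wf blocks ends aa' b'b a'∈ b'∈ leaf = ¬Cyclic⇒InArc a≢b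
  (Leaf-¬between-ends wf blocks ends (HullEdge⇒¬between aa' aa'b) (HullEdge⇒¬between b'b b'ba) leaf)
  where
  open SpineEnds ends
  aa'b : Cyclic a a' b
  aa'b = InArc⇒Cyclic a'∈ a'≢a a'≢b
  b'ba : Cyclic b' b a
  b'ba = Cyclic-rotate (InArc⇒Cyclic b'∈ b'≢a b'≢b)

claim1 : (n : ℕ) (B : EdgeSet n) → Blocker B → ¬ IsStar B → Caterpillar B →
    (a a' b' b : Fin n) (mid : List (Fin n)) →
    Spine B (a ∷ a' ∷ mid ++ b' ∷ b ∷ []) →
    HullEdge a a' → HullEdge b' b → a' ≢ b' →
    ((InArc a b a' × InArc a b b') ⊎ (InArc b a a' × InArc b a b')) →
    (c : Fin n) → Leaf B c →
    (InArc a b a' → InArc b a c) × (InArc b a a' → InArc a b c)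
claim1 n B (wf , blocks , _) _ cat a a' b' b mid spine aa' b'b _ arcs c leaf =
    (λ a'∈ab → Leaf-on-far-arc wf blocks ends aa' b'b a'∈ab (b'∈ab a'∈ab) leaf)
  , (λ a'∈ba → Leaf-on-far-arc wf blocks (SpineEnds-swap ends) (HullEdge-sym b'b) (HullEdge-sym aa')
                 (b'∈ba a'∈ba) a'∈ba leaf)
  where
  ends : SpineEnds B a a' b' b
  ends = Spine⇒SpineEnds mid cat spine
  open SpineEnds ends
  a'-not-on-both : InArc a b a' → ¬ InArc b a a'
  a'-not-on-both a'∈ab a'∈ba = Sum.[ a'≢a , a'≢b ]′ (InArc-both a'∈ab a'∈ba)
  b'∈ab : InArc a b a' → InArc a b b'
  b'∈ab a'∈ab = Sum.[ proj₂ , ⊥-elim ∘ a'-not-on-both a'∈ab ∘ proj₁ ]′ arcs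
  b'∈ba : InArc b a a' → InArc b a b'
  b'∈ba a'∈ba = Sum.[ ⊥-elim ∘ (λ a'∈ab → a'-not-on-both a'∈ab a'∈ba) ∘ proj₁ , proj₂ ]′ arcs
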